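{- Let $\mathcal{P} = (\mathcal{X}, C)$ denote a program over $(A, \sqsubseteq)$. If we have $[\![C]\!]^k(\bot) = \mathrm{MFP}(\mathcal{P})$ for some $k \in \mathbb{N}$, then $\mathcal{P}$ is MFP-accelerable.
   Context: $(A, \sqsubseteq)$ is a complete lattice with least element $\bot$; lattices of functions into $A$ are ordered pointwise. For a monotonic $f$, $f^*(x)$ denotes the least post-fix-point of $f$ greater than $x$, i.e. the greatest lower bound of $\{a \mid (x \sqcup f(a)) \sqsubseteq a\}$. A program is $\mathcal{P} = (\mathcal{X}, C)$ with $\mathcal{X}$ a finite set of variables and $C$ a finite set of commands $\langle X_1, \ldots, X_n ; f ; X \rangle$ (pairwise distinct inputs, monotonic $f \in A^n \rightarrow A$, output $X$). A valuation is $\rho \in \mathcal{X} \rightarrow A$; $[\![c]\!](\rho)(X) = f(\rho(X_1), \ldots, \rho(X_n))$ and $[\![c]\!](\rho)(Y) = \rho(Y)$ for $Y \neq X$. For traces: $[\![\varepsilon]\!]$ is the identity, $[\![c \cdot \sigma]\!] = [\![\sigma]\!] \circ [\![c]\!]$, and $[\![L]\!] = \bigsqcup_{\sigma \in L} [\![\sigma]\!]$ for a language $L$; in particular $[\![C]\!] = \bigsqcup_{c \in C}[\![c]\!]$, and $[\![C]\!]^k$ is its $k$-fold iterate. $\mathrm{MFP}(\mathcal{P})$ is the greatest lower bound of all valuations $\rho$ with $[\![c]\!](\rho) \sqsubseteq \rho$ for all $c \in C$. $\mathcal{P}$ is MFP-accelerable if $\mathrm{MFP}(\mathcal{P}) =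 ([\![\sigma_k]\!]^* \circ \cdots \circ [\![\sigma_1]\!]^*)(\bot)$ for some words $\sigma_1, \ldots, \sigma_k \in C^*$. -}

module Defs where

open import Level using (Level; suc)
open import Data.Nat using (ℕ)
open import Data.Fin using (Fin; _≟_)
open import Data.List using (List; []; _∷_)
open import Data.Product using (Σ; ∃; _×_; _,_)
open import Data.Sum using (_⊎_)
open import Function using (_∘_; id)
open import Function.Definitions using (Injective)
open import Relation.Nullary using (yes; no)
open import Relation.Binary.Core using (Rel)
open import Relation.Binary.Structures using (IsPartialOrder)
open import Relation.Binary.PropositionalEquality using (_≡_)

record CompleteLattice (a : Level) : Set (suc a) where
  field
    Carrier : Set a
    _≈_     : Rel Carrier a
    _⊑_     : Rel Carrier a
    isPartialOrder : IsPartialOrder _≈_ _⊑_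
    ⋀ : (Carrier → Set a) → Carrier
    ⋀-lower    : ∀ (S : Carrier → Set a) x → S x → ⋀ S ⊑ x
    ⋀-greatest : ∀ (S : Carrier → Set a) y → (∀ x → S x → y ⊑ x) → y ⊑ ⋀ S
    ⋁ : (Carrier → Set a) → Carrier
    ⋁-upper : ∀ (S : Carrier → Set a) x → S x → x ⊑ ⋁ S
    ⋁-least : ∀ (S : Carrier → Set a) y → (∀ x → S x → x ⊑ y) → ⋁ S ⊑ y

  ⊥ : Carrier
  ⊥ = ⋁ (λ _ → Lift)
    where
      Lift : Set a
      Lift = Level.Lift a Empty
        where open import Data.Empty using () renaming (⊥ to Empty)

  _⊔_ : Carrier → Carrier → Carrier
  x ⊔ y = ⋁ (λ z → (z ≈ x) ⊎ (z ≈ y))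

module _ {a : Level} (L : CompleteLattice a) where
  open CompleteLattice L

  Monotone : ∀ {n} → ((Fin n → Carrier) → Carrier) → Set a
  Monotone {n} f = ∀ (u v : Fin n → Carrier) → (∀ i → u i ⊑ v i) → f u ⊑ f v

  record Command (N : ℕ) : Set a where
    field
      arity    : ℕ
      inputs   : Fin arity → Fin N
      distinct : Injective _≡_ _≡_ inputs
      fun      : (Fin arity → Carrier) → Carrier
      mono     : Monotone fun
      output   : Fin N

  -- A program (𝒳, C): 𝒳 = Fin N (a finite set of variables),
  -- C = a finite set of commands, enumerated by Fin m.
  record Program : Set a where
    field
      nVars : ℕ
      nCmds : ℕ
      cmd   : Fin nCmds → Command nVars

  module _ (P : Program) where
    open Program P

    Valuation : Set a
    Valuation = Fin nVars → Carrier

    _⊑ᵥ_ : Valuation → Valuation → Set a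
    ρ ⊑ᵥ ρ' = ∀ Y → ρ Y ⊑ ρ' Y

    _≈ᵥ_ : Valuation → Valuation → Set a
    ρ ≈ᵥ ρ' = ∀ Y → ρ Y ≈ ρ' Y

    _⊔ᵥ_ : Valuation → Valuation → Valuation
    (ρ ⊔ᵥ ρ') Y = ρ Y ⊔ ρ' Y

    ⊥ᵥ : Valuation
    ⊥ᵥ _ = ⊥

    ⋀ᵥ : (Valuation → Set a) → Valuation
    ⋀ᵥ S Y = ⋀ (λ v → Σ Valuation (λ ρ → S ρ × (v ≈ ρ Y)))

    ⟦_⟧ᶜ : Command nVars → Valuation → Valuation
    ⟦ c ⟧ᶜ ρ Y with Y ≟ Command.output c
    ... | yes _ = Command.fun c (ρ ∘ Command.inputs c)
    ... | no  _ = ρ Y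

    ⟦_⟧ʷ : List (Fin nCmds) → Valuation → Valuation
    ⟦ [] ⟧ʷ = id
    ⟦ i ∷ σ ⟧ʷ = ⟦ σ ⟧ʷ ∘ ⟦ cmd i ⟧ᶜ

    ⟦C⟧ : Valuation → Valuation
    ⟦C⟧ ρ Y = ⋁ (λ v → Σ (Fin nCmds) (λ i → v ≈ ⟦ cmd i ⟧ᶜ ρ Y))

    iter : ℕ → (Valuation → Valuation) → Valuation → Valuation
    iter ℕ.zero    g = id
    iter (ℕ.suc k) g = g ∘ iter k g

    _* : (Valuation → Valuation) → Valuation → Valuation
    (f *) x = ⋀ᵥ (λ ρ → (x ⊔ᵥ f ρ) ⊑ᵥ ρ)

    MFP : Valuation
    MFP = ⋀ᵥ (λ ρ → ∀ i → ⟦ cmd i ⟧ᶜ ρ ⊑ᵥ ρ)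

    accel : List (List (Fin nCmds)) → Valuation → Valuation
    accel []       x = x
    accel (σ ∷ σs) x = accel σs ((⟦ σ ⟧ʷ *) x)

    MFP-accelerable : Set a
    MFP-accelerable = Σ (List (List (Fin nCmds))) (λ σs → MFP ≈ᵥ accel σs ⊥ᵥ)

module Submission where

-- Let ws = [c₁] ∷ … ∷ [cₘ] ∷ [] be the list of one-letter words, one per
-- command, and accelerate with k consecutive copies of ws.
--
--  * lower bound:  f(x) ⊑ f*(x) and x ⊑ f*(x) for every monotone f, so one
--    pass through ws already dominates every single command, hence their
--    join ⟦C⟧; by monotonicity k passes dominate ⟦C⟧ᵏ(⊥) = MFP.
--  * upper bound:  MFP, as a glb of post-fix-points of the monotone
--    commands, is itself a post-fix-point of every command, hence of every
--    word; f*(x) lies below every post-fix-point of f above x, so each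
--    acceleration step starting below MFP stays below MFP.

open import Defs
open import Level using (Level)
open import Data.Nat using (ℕ; zero; suc)
open import Data.Product using (_,_)
open import Data.Sum using (inj₁; inj₂)
open import Data.Fin using (Fin; _≟_)
open import Data.List using (List; []; _∷_; _++_; map; allFin; [_])
open import Data.List.Relation.Unary.Any using (here; there)
open import Data.List.Membership.Propositional using (_∈_)
open import Data.List.Membership.Propositional.Properties using (∈-allFin; ∈-map⁺)
open import Relation.Nullary using (yes; no)
open import Relation.Binary.Structures using (IsPartialOrder)
open import Relation.Binary.PropositionalEquality using (_≡_; refl; sym; subst)

module LatticeFacts {a : Level} (L : CompleteLattice a) where
  open CompleteLattice L
  open IsPartialOrder isPartialOrder
    renaming (refl to ⊑-refl; trans to ⊑-trans)

  ⊔-upperˡ : ∀ x y → x ⊑ (x ⊔ y)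
  ⊔-upperˡ x y = ⋁-upper _ x (inj₁ Eq.refl)

  ⊔-upperʳ : ∀ x y → y ⊑ (x ⊔ y)
  ⊔-upperʳ x y = ⋁-upper _ y (inj₂ Eq.refl)

  ⊔-least : ∀ {x y z} → x ⊑ z → y ⊑ z → (x ⊔ y) ⊑ z
  ⊔-least x⊑z y⊑z = ⋁-least _ _ λ
    { w (inj₁ w≈x) → ⊑-trans (reflexive w≈x) x⊑z
    ; w (inj₂ w≈y) → ⊑-trans (reflexive w≈y) y⊑z }

  ⊥-least : ∀ x → ⊥ ⊑ x
  ⊥-least x = ⋁-least _ x λ _ ()

module Acceleration {a : Level} (L : CompleteLattice a) (P : Program L) where
  open CompleteLattice L
  open IsPartialOrder isPartialOrder
    renaming (refl to ⊑-refl; trans to ⊑-trans)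
  open LatticeFacts L
  open Program P

  Val : Set a
  Val = Valuation L P

  Word : Set
  Word = List (Fin nCmds)

  infix 4 _⊑̇_
  _⊑̇_ : Val → Val → Set a
  _⊑̇_ = _⊑ᵥ_ L P

  ⊑̇-trans : ∀ {ρ ρ′ ρ″} → ρ ⊑̇ ρ′ → ρ′ ⊑̇ ρ″ → ρ ⊑̇ ρ″
  ⊑̇-trans ρ⊑ρ′ ρ′⊑ρ″ Y = ⊑-trans (ρ⊑ρ′ Y) (ρ′⊑ρ″ Y)

  Monotonic : (Val → Val) → Set a
  Monotonic f = ∀ {ρ ρ′} → ρ ⊑̇ ρ′ → f ρ ⊑̇ f ρ′

  ⟪_⟫ᶜ : Command L nVars → Val → Val
  ⟪_⟫ᶜ = ⟦_⟧ᶜ L P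

  ⟪_⟫ʷ : Word → Val → Val
  ⟪_⟫ʷ = ⟦_⟧ʷ L P

  _⋆ : (Val → Val) → Val → Val
  _⋆ = _* L P

  acc : List Word → Val → Val
  acc = accel L P

  ⋀ᵥ-lower : ∀ S {ρ} → S ρ → ⋀ᵥ L P S ⊑̇ ρ
  ⋀ᵥ-lower S {ρ} ρ∈S Y = ⋀-lower _ _ (ρ , ρ∈S , Eq.refl)

  ⋀ᵥ-greatest : ∀ S {ρ} → (∀ ρ′ → S ρ′ → ρ ⊑̇ ρ′) → ρ ⊑̇ ⋀ᵥ L P S
  ⋀ᵥ-greatest S below Y = ⋀-greatest _ _ λ
    { v (ρ′ , ρ′∈S , v≈ρ′Y) → ⊑-trans (below ρ′ ρ′∈S Y) (reflexive (Eq.sym v≈ρ′Y)) }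

  ⋀ᵥ-post : ∀ S {f} → Monotonic f → (∀ ρ → S ρ → f ρ ⊑̇ ρ) →
            f (⋀ᵥ L P S) ⊑̇ ⋀ᵥ L P S
  ⋀ᵥ-post S f-mono post = ⋀ᵥ-greatest S λ ρ ρ∈S →
    ⊑̇-trans (f-mono (⋀ᵥ-lower S ρ∈S)) (post ρ ρ∈S)

  ⊔ᵥ-boundˡ : ∀ {x y ρ} → _⊔ᵥ_ L P x y ⊑̇ ρ → x ⊑̇ ρ
  ⊔ᵥ-boundˡ x⊔y⊑ρ Y = ⊑-trans (⊔-upperˡ _ _) (x⊔y⊑ρ Y)

  ⊔ᵥ-boundʳ : ∀ {x y ρ} → _⊔ᵥ_ L P x y ⊑̇ ρ → y ⊑̇ ρ
  ⊔ᵥ-boundʳ x⊔y⊑ρ Y = ⊑-trans (⊔-upperʳ _ _) (x⊔y⊑ρ Y)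

  ⋆-inflationary : ∀ f x → x ⊑̇ (f ⋆) x
  ⋆-inflationary f x = ⋀ᵥ-greatest _ λ ρ → ⊔ᵥ-boundˡ

  ⋆-above-image : ∀ {f} → Monotonic f → ∀ x → f x ⊑̇ (f ⋆) x
  ⋆-above-image f-mono x = ⋀ᵥ-greatest _ λ ρ post →
    ⊑̇-trans (f-mono (⊔ᵥ-boundˡ post)) (⊔ᵥ-boundʳ post)

  ⋆-least : ∀ f {x ρ} → _⊔ᵥ_ L P x (f ρ) ⊑̇ ρ → (f ⋆) x ⊑̇ ρ
  ⋆-least f post = ⋀ᵥ-lower _ post

  command-mono : ∀ c → Monotonic ⟪ c ⟫ᶜ
  command-mono c ρ⊑ρ′ Y with Y ≟ Command.output c
  ... | yes _ = Command.mono c _ _ (λ i → ρ⊑ρ′ (Command.inputs c i))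
  ... | no  _ = ρ⊑ρ′ Y

  word-mono : ∀ σ → Monotonic ⟪ σ ⟫ʷ
  word-mono []      ρ⊑ρ′ = ρ⊑ρ′
  word-mono (i ∷ σ) ρ⊑ρ′ = word-mono σ (command-mono (cmd i) ρ⊑ρ′)

  ⟦C⟧-mono : Monotonic (⟦C⟧ L P)
  ⟦C⟧-mono ρ⊑ρ′ Y = ⋁-least _ _ λ
    { v (i , v≈) → ⊑-trans (reflexive v≈)
                   (⊑-trans (command-mono (cmd i) ρ⊑ρ′ Y) (⋁-upper _ _ (i , Eq.refl))) }

  word-post : ∀ {ρ} → (∀ i → ⟪ cmd i ⟫ᶜ ρ ⊑̇ ρ) → ∀ σ → ⟪ σ ⟫ʷ ρ ⊑̇ ρ
  word-post post []      = λ Y → ⊑-refl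
  word-post post (i ∷ σ) = ⊑̇-trans (word-mono σ (post i)) (word-post post σ)

  acc-inflationary : ∀ σs x → x ⊑̇ acc σs x
  acc-inflationary []       x = λ Y → ⊑-refl
  acc-inflationary (σ ∷ σs) x =
    ⊑̇-trans (⋆-inflationary ⟪ σ ⟫ʷ x) (acc-inflationary σs _)

  acc-++ : ∀ σs τs x → acc (σs ++ τs) x ≡ acc τs (acc σs x)
  acc-++ []       τs x = refl
  acc-++ (σ ∷ σs) τs x = acc-++ σs τs _

  acc-above-word : ∀ {σ σs} → σ ∈ σs → ∀ x → ⟪ σ ⟫ʷ x ⊑̇ acc σs x
  acc-above-word {σ} {σ ∷ τs} (here refl) x =
    ⊑̇-trans (⋆-above-image (word-mono σ) x) (acc-inflationary τs _)
  acc-above-word {σ} {τ ∷ τs} (there σ∈τs) x =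
    ⊑̇-trans (word-mono σ (⋆-inflationary ⟪ τ ⟫ʷ x)) (acc-above-word σ∈τs _)

  acc-below-post : ∀ {ρ} → (∀ i → ⟪ cmd i ⟫ᶜ ρ ⊑̇ ρ) →
                   ∀ σs {x} → x ⊑̇ ρ → acc σs x ⊑̇ ρ
  acc-below-post post []       x⊑ρ = x⊑ρ
  acc-below-post post (σ ∷ σs) x⊑ρ = acc-below-post post σs
    (⋆-least ⟪ σ ⟫ʷ (λ Y → ⊔-least (x⊑ρ Y) (word-post post σ Y)))

  singletons : List Word
  singletons = map [_] (allFin nCmds)

  ⟦C⟧-below-singletons : ∀ x → ⟦C⟧ L P x ⊑̇ acc singletons x
  ⟦C⟧-below-singletons x Y = ⋁-least _ _ λ
    { v (i , v≈) → ⊑-trans (reflexive v≈)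
                   (acc-above-word (∈-map⁺ [_] (∈-allFin i)) x Y) }

  repeat : ℕ → List Word → List Word
  repeat zero    ws = []
  repeat (suc j) ws = repeat j ws ++ ws

  iter-below-repeat : ∀ {g ws} → Monotonic g → (∀ x → g x ⊑̇ acc ws x) →
                      ∀ j x → iter L P j g x ⊑̇ acc (repeat j ws) x
  iter-below-repeat g-mono g⊑ws zero    x = acc-inflationary [] x
  iter-below-repeat {g} {ws} g-mono g⊑ws (suc j) x =
    subst (iter L P (suc j) g x ⊑̇_) (sym (acc-++ (repeat j ws) ws x))
      (⊑̇-trans (g-mono (iter-below-repeat g-mono g⊑ws j x)) (g⊑ws _))

  MFP-post : ∀ i → ⟪ cmd i ⟫ᶜ (MFP L P) ⊑̇ MFP L P
  MFP-post i = ⋀ᵥ-post _ (command-mono (cmd i)) λ ρ post → post i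

  ⊥ᵥ-least : ∀ ρ → ⊥ᵥ L P ⊑̇ ρ
  ⊥ᵥ-least ρ Y = ⊥-least (ρ Y)

mainTheorem2 : ∀ {a : Level} (L : CompleteLattice a) (P : Program L) (k : ℕ) →
                 _≈ᵥ_ L P (iter L P k (⟦C⟧ L P) (⊥ᵥ L P)) (MFP L P) →
                 MFP-accelerable L P
mainTheorem2 L P k iterate≈MFP = rounds , λ Y → antisym (MFP⊑acc Y) (acc⊑MFP Y)
  where
    open CompleteLattice L
    open IsPartialOrder isPartialOrder using (antisym; reflexive; module Eq)
    open Acceleration L P

    rounds : List Word
    rounds = repeat k singletons

    MFP⊑acc : MFP L P ⊑̇ acc rounds (⊥ᵥ L P)
    MFP⊑acc = ⊑̇-trans (λ Y → reflexive (Eq.sym (iterate≈MFP Y)))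
      (iter-below-repeat ⟦C⟧-mono ⟦C⟧-below-singletons k (⊥ᵥ L P))

    acc⊑MFP : acc rounds (⊥ᵥ L P) ⊑̇ MFP L P
    acc⊑MFP = acc-below-post MFP-post rounds (⊥ᵥ-least (MFP L P))
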